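{- Let $G$ be a graph on $n\geq 1$ vertices. Then (1) $\mathcal{Z}(G;x)=\mathcal{Z}(P_n;x)$ if and only if $G\simeq P_n$; and (2) $\mathcal{Z}(G;x)=\mathcal{Z}(K_n;x)$ if and only if $G\simeq K_n$.
   Context: $P_n$ and $K_n$ are the path and complete graph on $n$ vertices. Zero forcing: given a set of colored vertices, a colored vertex $u$ with exactly one uncolored neighbor $v$ may force $v$ to become colored; $S$ is a zero forcing set if starting with $S$ colored and repeatedly applying this rule colors all vertices. $z(G;i)$ is the number of zero forcing sets of size $i$ and $\mathcal{Z}(G;x)=\sum_{i=1}^n z(G;i)x^i$. -}

module Defs where

open import Data.Nat using (ℕ; zero; suc; _+_; _≤_)
open import Data.Bool using (Bool; true; false; _∧_; _∨_; not; if_then_else_)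
open import Data.Fin using (Fin; toℕ)
open import Data.Fin.Permutation using (Permutation′; _⟨$⟩ʳ_)
open import Data.List using (List; []; _∷_; map; _++_; length; filter)
open import Data.Product using (Σ; ∃; _×_; _,_)
open import Relation.Binary.PropositionalEquality using (_≡_; refl; sym)
open import Relation.Nullary using (yes; no)
open import Relation.Nullary.Decidable using (⌊_⌋; _×-dec_)
open import Data.Empty using (⊥-elim)
open import Data.Nat.Properties using (1+n≢n)
open import Data.Bool.Properties using (∨-comm)
import Data.Nat as ℕ
import Data.Fin as F
import Data.Bool as B

record Graph (n : ℕ) : Set where
  field
    adj   : Fin n → Fin n → Bool
    symm  : ∀ u v → adj u v ≡ adj v u
    loopless : ∀ v → adj v v ≡ false
open Graph public

_≃G_ : ∀ {n} → Graph n → Graph n → Set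
_≃G_ {n} G H = Σ (Permutation′ n) λ σ → ∀ u v → adj G u v ≡ adj H (σ ⟨$⟩ʳ u) (σ ⟨$⟩ʳ v)

P : (n : ℕ) → Graph n
P n = record { adj = a ; symm = s ; loopless = l }
  where
  a : Fin n → Fin n → Bool
  a i j = ⌊ suc (toℕ i) ℕ.≟ toℕ j ⌋ ∨ ⌊ suc (toℕ j) ℕ.≟ toℕ i ⌋
  s : ∀ u v → a u v ≡ a v u
  s u v = ∨-comm ⌊ suc (toℕ u) ℕ.≟ toℕ v ⌋ ⌊ suc (toℕ v) ℕ.≟ toℕ u ⌋
  l : ∀ v → a v v ≡ false
  l v with suc (toℕ v) ℕ.≟ toℕ v
  ... | yes p = ⊥-elim (1+n≢n p)
  ... | no _ = refl

K : (n : ℕ) → Graph n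
K n = record { adj = a ; symm = s ; loopless = l }
  where
  a : Fin n → Fin n → Bool
  a i j = not ⌊ i F.≟ j ⌋
  s : ∀ u v → a u v ≡ a v u
  s u v with u F.≟ v | v F.≟ u
  ... | yes _ | yes _ = refl
  ... | no _ | no _ = refl
  ... | yes p | no q = ⊥-elim (q (sym p))
  ... | no q | yes p = ⊥-elim (q (sym p))
  l : ∀ v → a v v ≡ false
  l v with v F.≟ v
  ... | yes _ = refl
  ... | no q = ⊥-elim (q refl)

anyV : ∀ {n} → (Fin n → Bool) → Bool
anyV {zero} f = false
anyV {suc n} f = f F.zero ∨ anyV (λ i → f (F.suc i))

countV : ∀ {n} → (Fin n → Bool) → ℕ
countV {zero} f = 0
countV {suc n} f = (if f F.zero then 1 else 0) + countV (λ i → f (F.suc i))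

Coloring : ℕ → Set
Coloring n = Fin n → Bool

forces : ∀ {n} → Graph n → Coloring n → Fin n → Fin n → Bool
forces G c u v = c u ∧ adj G u v ∧ not (c v)
                 ∧ ⌊ countV (λ w → adj G u w ∧ not (c w)) ℕ.≟ 1 ⌋

step : ∀ {n} → Graph n → Coloring n → Coloring n
step G c v = c v ∨ anyV (λ u → forces G c u v)

iter : ∀ {n} → ℕ → Graph n → Coloring n → Coloring n
iter zero G c = c
iter (suc k) G c = iter k G (step G c)

-- Final colouring obtained by applying the forcing rule until no more changes
-- (n rounds suffice: each non-final round colours at least one new vertex).
closure : ∀ {n} → Graph n → Coloring n → Coloring n
closure {n} G c = iter n G c

isZFS : ∀ {n} → Graph n → Coloring n → Bool
isZFS G S = not (anyV (λ v → not (closure G S v)))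

subsets : (n : ℕ) → List (Coloring n)
subsets zero = (λ ()) ∷ []
subsets (suc n) = map (ext false) (subsets n) ++ map (ext true) (subsets n)
  where
  ext : Bool → Coloring n → Coloring (suc n)
  ext b S F.zero = b
  ext b S (F.suc i) = S i

z : ∀ {n} → Graph n → ℕ → ℕ
z {n} G i = length (filter (λ S → (countV S ℕ.≟ i) ×-dec (isZFS G S B.≟ true)) (subsets n))

-- 𝒵(G;x) = 𝒵(H;x): equality of all coefficients z(·;i), 1 ≤ i ≤ n.
ZPolyEq : ∀ {n} → Graph n → Graph n → Set
ZPolyEq {n} G H = ∀ i → 1 ≤ i → i ≤ n → z G i ≡ z H i

module Submission where

-- Backward directions: z(G;i) counts the colourings of size i that are zero
-- forcing sets, and an isomorphism σ : G ≅ H turns zero forcing sets of H into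
-- zero forcing sets of G by precomposition; precomposition with a permutation
-- preserves both the size of a set and the number of sets with a property.
--
-- Path: z(P_n;1) ≥ 1 since an endpoint forces the whole path, so G has a zero
-- forcing set {v}.  Starting from one vertex, at every moment only the most
-- recently coloured vertex can force, so the forcing process traces a chain
-- w₀, w₁, …, wₖ whose induced adjacency is that of a path; since the process
-- colours everything, the chain enumerates V(G) and gives G ≅ P_n.
--
-- Complete graph (n ≥ 2): in K_n every set of size n-1 is zero forcing and no
-- set of size n-2 is.  Comparing counts, every (n-1)-set is zero forcing in G,
-- so G has no isolated vertex; and if u ≁ v then, picking w ~ u and x ~ v, the
-- set V ∖ {w, v} of size n-2 is zero forcing in G (u forces w, then x forces v),
-- contradicting z(G;n-2) = 0.  So G = K_n.

open import Defs
open import Data.Nat as ℕ using (ℕ; zero; suc; _+_; _≤_; _<_; z≤n; s≤s)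
open import Data.Nat.Properties
import Algebra.Properties.CommutativeSemigroup as CommSemigroupProperties
open import Algebra.Bundles using (CommutativeMonoid)
open import Data.Bool as B using (Bool; true; false; _∧_; _∨_; not; if_then_else_)
open import Data.Bool.Properties
  using (∨-zeroʳ; ∨-identityʳ; ∧-zeroʳ; ∧-conicalˡ; ∧-conicalʳ; not-involutive; ∨-comm; ∨-commutativeMonoid)
open import Data.Fin as F using (Fin; toℕ; fromℕ<; punchIn)
open import Data.Fin.Properties using (toℕ-injective; toℕ<n; toℕ-fromℕ<)
open import Data.Fin.Permutation using (Permutation′; _⟨$⟩ʳ_; permutation; remove; punchIn-permute)
import Data.Fin.Permutation as Perm
open import Data.List using (List; []; _∷_; map; _++_; length; filter)
open import Data.List.Membership.Propositional using (_∈_)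
open import Data.List.Membership.Propositional.Properties using (∈-map⁺; ∈-++⁺ˡ; ∈-++⁺ʳ)
open import Data.List.Relation.Unary.Any using (here; there)
open import Data.Product using (Σ-syntax; _×_; _,_; proj₁; proj₂)
open import Data.Sum using (_⊎_; inj₁; inj₂)
open import Data.Empty using (⊥; ⊥-elim)
open import Function using (_∘_)
open import Function.Bundles using (_⇔_; mk⇔)
open import Relation.Binary.PropositionalEquality
open import Relation.Nullary using (Dec; yes; no; does; proof; ¬_)
open import Relation.Nullary.Reflects using (Reflects; invert)
open import Relation.Nullary.Decidable using (⌊_⌋; _×-dec_; dec-true; dec-false; isYes≗does; ⌊⌋-map′)

true≢false : true ≢ false
true≢false ()

not-true : ∀ {b} → not b ≡ true → b ≡ false
not-true {b} e = trans (sym (not-involutive b)) (cong not e)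

⌊⌋-yes : ∀ {A : Set} (a? : Dec A) → A → ⌊ a? ⌋ ≡ true
⌊⌋-yes a? a = trans (isYes≗does a?) (dec-true a? a)

⌊⌋-no : ∀ {A : Set} (a? : Dec A) → ¬ A → ⌊ a? ⌋ ≡ false
⌊⌋-no a? ¬a = trans (isYes≗does a?) (dec-false a? ¬a)

both : ∀ {a b} → a ≡ true → b ≡ true → a ∧ b ≡ true
both refl refl = refl

not-false⇒true : ∀ b → (b ≡ false → ⊥) → b ≡ true
not-false⇒true false b≢false = ⊥-elim (b≢false refl)
not-false⇒true true _ = refl

∧-redundant : ∀ a {b} → (a ≡ true → b ≡ true) → a ∧ b ≡ a
∧-redundant false a⇒b = refl
∧-redundant true a⇒b = a⇒b refl

∧-refuted : ∀ a {b} → (a ≡ true → b ≡ false) → a ∧ b ≡ false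
∧-refuted false a⇒¬b = refl
∧-refuted true a⇒¬b = a⇒¬b refl

indicator : Bool → ℕ
indicator b = if b then 1 else 0

countV-ext : ∀ {n} {f g : Fin n → Bool} → (∀ x → f x ≡ g x) → countV f ≡ countV g
countV-ext {zero} e = refl
countV-ext {suc n} e = cong₂ (λ a b → indicator a + b) (e F.zero) (countV-ext (e ∘ F.suc))

anyV-ext : ∀ {n} {f g : Fin n → Bool} → (∀ x → f x ≡ g x) → anyV f ≡ anyV g
anyV-ext {zero} e = refl
anyV-ext {suc n} e = cong₂ _∨_ (e F.zero) (anyV-ext (e ∘ F.suc))

anyV-witness : ∀ {n} (f : Fin n → Bool) → anyV f ≡ true → Σ[ u ∈ Fin n ] f u ≡ true
anyV-witness {suc n} f e with f F.zero in eq
... | true = F.zero , eq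
... | false with anyV-witness (f ∘ F.suc) e
... | u , fu = F.suc u , fu

anyV-intro : ∀ {n} (f : Fin n → Bool) u → f u ≡ true → anyV f ≡ true
anyV-intro f F.zero fu rewrite fu = refl
anyV-intro f (F.suc u) fu rewrite anyV-intro (f ∘ F.suc) u fu = ∨-zeroʳ (f F.zero)

anyV-none : ∀ {n} (f : Fin n → Bool) → (∀ u → f u ≡ false) → anyV f ≡ false
anyV-none {zero} f h = refl
anyV-none {suc n} f h rewrite h F.zero = anyV-none (f ∘ F.suc) (h ∘ F.suc)

anyV-false : ∀ {n} (f : Fin n → Bool) → anyV f ≡ false → ∀ u → f u ≡ false
anyV-false f e u with f u in eq
... | false = refl
... | true = ⊥-elim (true≢false (trans (sym (anyV-intro f u eq)) e))

countV-pos : ∀ {n} (f : Fin n → Bool) u → f u ≡ true → 1 ≤ countV f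
countV-pos f F.zero fu rewrite fu = s≤s z≤n
countV-pos f (F.suc u) fu =
  ≤-trans (countV-pos (f ∘ F.suc) u fu) (m≤n+m _ (indicator (f F.zero)))

countV-witness : ∀ {n} (f : Fin n → Bool) → 1 ≤ countV f → Σ[ u ∈ Fin n ] f u ≡ true
countV-witness {suc n} f h with f F.zero in eq
... | true = F.zero , eq
... | false with countV-witness (f ∘ F.suc) h
... | u , fu = F.suc u , fu

countV-none : ∀ {n} (f : Fin n → Bool) → (∀ u → f u ≡ false) → countV f ≡ 0
countV-none {zero} f h = refl
countV-none {suc n} f h rewrite h F.zero = countV-none (f ∘ F.suc) (h ∘ F.suc)

countV-zero : ∀ {n} (f : Fin n → Bool) → countV f ≡ 0 → ∀ u → f u ≡ false
countV-zero f e u with f u in eq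
... | false = refl
... | true = ⊥-elim (1+n≰n (subst (1 ≤_) e (countV-pos f u eq)))

countV-all : ∀ {n} (f : Fin n → Bool) → (∀ u → f u ≡ true) → countV f ≡ n
countV-all {zero} f h = refl
countV-all {suc n} f h rewrite h F.zero = cong suc (countV-all (f ∘ F.suc) (h ∘ F.suc))

countV-one : ∀ {n} (f : Fin n → Bool) → countV f ≡ 1 →
  Σ[ y ∈ Fin n ] (f y ≡ true × (∀ t → f t ≡ true → t ≡ y))
countV-one {suc n} f e with f F.zero in eq
... | true = F.zero , eq , unique
  where
  unique : ∀ t → f t ≡ true → t ≡ F.zero
  unique F.zero _ = refl
  unique (F.suc t) ft with () ← trans (sym ft) (countV-zero (f ∘ F.suc) (suc-injective e) t)
... | false with countV-one (f ∘ F.suc) e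
... | y , fy , uniqueʸ = F.suc y , fy , unique
  where
  unique : ∀ t → f t ≡ true → t ≡ F.suc y
  unique F.zero ft with () ← trans (sym ft) eq
  unique (F.suc t) ft = cong F.suc (uniqueʸ t ft)

countV-compl : ∀ {n} (f : Fin n → Bool) → countV f + countV (not ∘ f) ≡ n
countV-compl {zero} f = refl
countV-compl {suc n} f with f F.zero
... | true = cong suc (countV-compl (f ∘ F.suc))
... | false = trans (+-suc (countV (f ∘ F.suc)) _) (cong suc (countV-compl (f ∘ F.suc)))

_is_ : ∀ {n} → Fin n → Fin n → Bool
t is y = ⌊ t F.≟ y ⌋

is-suc : ∀ {n} (t y : Fin n) → (F.suc t is F.suc y) ≡ (t is y)
is-suc t y = ⌊⌋-map′ _ _ (t F.≟ y)

countV-singleton : ∀ {n} (y : Fin n) → countV (_is y) ≡ 1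
countV-singleton {suc n} F.zero = cong suc (countV-none {n} (λ t → F.suc t is F.zero) (λ _ → refl))
countV-singleton {suc n} (F.suc y) =
  trans (countV-ext (λ t → is-suc t y)) (countV-singleton y)

countV-insert : ∀ {n} (c : Fin n → Bool) y → c y ≡ false →
  countV (λ t → c t ∨ (t is y)) ≡ suc (countV c)
countV-insert {suc n} c F.zero cy rewrite cy =
  cong suc (countV-ext (λ t → ∨-identityʳ (c (F.suc t))))
countV-insert {suc n} c (F.suc y) cy = begin
  indicator (c F.zero ∨ false) + countV (λ t → c (F.suc t) ∨ (F.suc t is F.suc y))
    ≡⟨ cong₂ _+_ (cong indicator (∨-identityʳ (c F.zero)))
                 (countV-ext (λ t → cong (c (F.suc t) ∨_) (is-suc t y))) ⟩
  indicator (c F.zero) + countV (λ t → c (F.suc t) ∨ (t is y))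
    ≡⟨ cong (indicator (c F.zero) +_) (countV-insert (c ∘ F.suc) y cy) ⟩
  indicator (c F.zero) + suc (countV (c ∘ F.suc))
    ≡⟨ +-suc (indicator (c F.zero)) _ ⟩
  suc (countV c) ∎
  where open ≡-Reasoning

-- Pointwise equality of colourings; there is no function extensionality, so
-- every construction on colourings is shown to respect it.
_≈_ : ∀ {n} → Coloring n → Coloring n → Set
c ≈ d = ∀ x → c x ≡ d x

uncoloured : ∀ {n} → Graph n → Coloring n → Fin n → Fin n → Bool
uncoloured G c u t = adj G u t ∧ not (c t)

forces-ext : ∀ {n} (G : Graph n) {c d : Coloring n} → c ≈ d → ∀ u v → forces G c u v ≡ forces G d u v
forces-ext G {c} {d} c≈d u v
  rewrite c≈d u | c≈d v | countV-ext (λ w → cong (λ b → adj G u w ∧ not b) (c≈d w)) = refl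

step-ext : ∀ {n} (G : Graph n) {c d : Coloring n} → c ≈ d → step G c ≈ step G d
step-ext G c≈d v = cong₂ _∨_ (c≈d v) (anyV-ext (λ u → forces-ext G c≈d u v))

iter-ext : ∀ {n} m (G : Graph n) {c d : Coloring n} → c ≈ d → iter m G c ≈ iter m G d
iter-ext zero G c≈d = c≈d
iter-ext (suc m) G c≈d = iter-ext m G (step-ext G c≈d)

isZFS-ext : ∀ {n} (G : Graph n) {c d : Coloring n} → c ≈ d → isZFS G c ≡ isZFS G d
isZFS-ext {n} G c≈d = cong not (anyV-ext (λ v → cong not (iter-ext n G c≈d v)))

step-mono : ∀ {n} (G : Graph n) (c : Coloring n) x → c x ≡ true → step G c x ≡ true
step-mono G c x cx rewrite cx = refl

iter-mono : ∀ {n} m (G : Graph n) (c : Coloring n) x → c x ≡ true → iter m G c x ≡ true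
iter-mono zero G c x cx = cx
iter-mono (suc m) G c x cx = iter-mono m G (step G c) x (step-mono G c x cx)

iter-stable : ∀ {n} m (G : Graph n) (c : Coloring n) → step G c ≈ c → iter m G c ≈ c
iter-stable zero G c stable x = refl
iter-stable (suc m) G c stable x = trans (iter-ext m G stable x) (iter-stable m G c stable x)

iter-frozen : ∀ {n} m (G : Graph n) v → (∀ c → step G c v ≡ c v) → ∀ c → iter m G c v ≡ c v
iter-frozen zero G v frozen c = refl
iter-frozen (suc m) G v frozen c = trans (iter-frozen m G v frozen (step G c)) (frozen c)

iter-later : ∀ {n} {k m} (G : Graph n) c x → k ≤ m → iter k G c x ≡ true → iter m G c x ≡ true
iter-later {m = m} G c x z≤n cx = iter-mono m G c x cx
iter-later G c x (s≤s k≤m) done = iter-later G (step G c) x k≤m done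

isZFS-sound : ∀ {n} (G : Graph n) S → isZFS G S ≡ true → ∀ x → closure G S x ≡ true
isZFS-sound G S zfs x with closure G S x in eq
... | true = refl
... | false with () ← trans (sym zfs) (cong not (anyV-intro (λ v → not (closure G S v)) x (cong not eq)))

isZFS-complete : ∀ {n} (G : Graph n) S → (∀ x → closure G S x ≡ true) → isZFS G S ≡ true
isZFS-complete G S all = cong not (anyV-none (λ v → not (closure G S v)) (λ v → cong not (all v)))

zfs-within : ∀ {n} (G : Graph n) S k → k ≤ n → (∀ x → iter k G S x ≡ true) → isZFS G S ≡ true
zfs-within G S k k≤n all = isZFS-complete G S (λ x → iter-later G S x k≤n (all x))

stable-zfs : ∀ {n} (G : Graph n) S → step G S ≈ S → isZFS G S ≡ true → ∀ x → S x ≡ true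
stable-zfs {n} G S stable zfs x = trans (sym (iter-stable n G S stable x)) (isZFS-sound G S zfs x)

step-force : ∀ {n} (G : Graph n) c u v → c u ≡ true → uncoloured G c u v ≡ true →
  countV (uncoloured G c u) ≡ 1 → step G c v ≡ true
step-force G c u v cu uv one = trans (cong (c v ∨_) (anyV-intro (λ w → forces G c w v) u u⇒v)) (∨-zeroʳ _)
  where
  u⇒v : forces G c u v ≡ true
  u⇒v = both cu (both (∧-conicalˡ (adj G u v) _ uv)
                  (both (∧-conicalʳ _ (not (c v)) uv) (⌊⌋-yes (countV (uncoloured G c u) ℕ.≟ 1) one)))

step-force-sole : ∀ {n} (G : Graph n) c u v → c u ≡ true → adj G u v ≡ true → c v ≡ false →
  (∀ t → t ≢ v → uncoloured G c u t ≡ false) → step G c v ≡ true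
step-force-sole G c u v cu uv cv others =
  step-force G c u v cu (trans (sole v) (⌊⌋-yes (v F.≟ v) refl)) (trans (countV-ext sole) (countV-singleton v))
  where
  sole : ∀ t → uncoloured G c u t ≡ (t is v)
  sole t with t F.≟ v
  ... | yes refl rewrite uv | cv = refl
  ... | no t≢v = others t t≢v

forces-inv : ∀ {n} (G : Graph n) c u v → forces G c u v ≡ true →
  c u ≡ true × uncoloured G c u v ≡ true × countV (uncoloured G c u) ≡ 1
forces-inv G c u v f with c u | adj G u v | c v | countV (uncoloured G c u) ℕ.≟ 1
forces-inv G c u v refl | true | true | false | yes one = refl , refl , one

step-unforced : ∀ {n} (G : Graph n) c v → (∀ u → forces G c u v ≡ false) → step G c v ≡ c v
step-unforced G c v none = trans (cong (c v ∨_) (anyV-none _ none)) (∨-identityʳ (c v))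

step-if-uncoloured : ∀ {n} (G : Graph n) c v → (c v ≡ false → step G c v ≡ true) → step G c v ≡ true
step-if-uncoloured G c v forced = by-colour (c v) refl
  where
  by-colour : ∀ b → c v ≡ b → step G c v ≡ true
  by-colour true cv = step-mono G c v cv
  by-colour false cv = forced cv

countL : ∀ {A : Set} → (A → Bool) → List A → ℕ
countL p [] = 0
countL p (x ∷ xs) = indicator (p x) + countL p xs

length-filter : ∀ {A : Set} {P : A → Set} (P? : ∀ x → Dec (P x)) xs →
  length (filter P? xs) ≡ countL (λ x → does (P? x)) xs
length-filter P? [] = refl
length-filter P? (x ∷ xs) with does (P? x)
... | true = cong suc (length-filter P? xs)
... | false = length-filter P? xs

countL-ext : ∀ {A : Set} {p q : A → Bool} → (∀ x → p x ≡ q x) → ∀ xs → countL p xs ≡ countL q xs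
countL-ext e [] = refl
countL-ext e (x ∷ xs) = cong₂ (λ a b → indicator a + b) (e x) (countL-ext e xs)

countL-++ : ∀ {A : Set} (p : A → Bool) xs ys → countL p (xs ++ ys) ≡ countL p xs + countL p ys
countL-++ p [] ys = refl
countL-++ p (x ∷ xs) ys = trans (cong (indicator (p x) +_) (countL-++ p xs ys)) (sym (+-assoc (indicator (p x)) _ _))

countL-map : ∀ {A C : Set} (p : C → Bool) (f : A → C) xs → countL p (map f xs) ≡ countL (p ∘ f) xs
countL-map p f [] = refl
countL-map p f (x ∷ xs) = cong (indicator (p (f x)) +_) (countL-map p f xs)

countL-pos : ∀ {A : Set} (p : A → Bool) {x xs} → x ∈ xs → p x ≡ true → 1 ≤ countL p xs
countL-pos p {x} (here refl) px rewrite px = s≤s z≤n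
countL-pos p {xs = y ∷ _} (there x∈) px = ≤-trans (countL-pos p x∈ px) (m≤n+m _ (indicator (p y)))

countL-witness : ∀ {A : Set} (p : A → Bool) xs → 1 ≤ countL p xs → Σ[ x ∈ A ] p x ≡ true
countL-witness p (x ∷ xs) h with p x in eq
... | true = x , eq
... | false = countL-witness p xs h

countL-none : ∀ {A : Set} (p : A → Bool) → (∀ x → p x ≡ false) → ∀ xs → countL p xs ≡ 0
countL-none p none [] = refl
countL-none p none (x ∷ xs) rewrite none x = countL-none p none xs

indicator-mono : ∀ {a b} → (a ≡ true → b ≡ true) → indicator a ≤ indicator b
indicator-mono {false} a⇒b = z≤n
indicator-mono {true} a⇒b rewrite a⇒b refl = ≤-refl

indicator-injective : ∀ {a b} → indicator a ≡ indicator b → a ≡ b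
indicator-injective {false} {false} _ = refl
indicator-injective {true} {true} _ = refl

equal-parts : ∀ {a b c d} → a ≤ c → b ≤ d → a + b ≡ c + d → a ≡ c × b ≡ d
equal-parts {a} {b} {c} {d} a≤c b≤d same = a≡c , +-cancelˡ-≡ a b d (trans same (cong (_+ d) (sym a≡c)))
  where
  a≡c : a ≡ c
  a≡c = ≤-antisym a≤c (+-cancelʳ-≤ d c a (subst (_≤ a + d) same (+-monoʳ-≤ a b≤d)))

countL-mono : ∀ {A : Set} {r q : A → Bool} → (∀ x → r x ≡ true → q x ≡ true) →
  ∀ xs → countL r xs ≤ countL q xs
countL-mono r⇒q [] = z≤n
countL-mono r⇒q (x ∷ xs) = +-mono-≤ (indicator-mono (r⇒q x)) (countL-mono r⇒q xs)

countL-saturated : ∀ {A : Set} {r q : A → Bool} → (∀ x → r x ≡ true → q x ≡ true) →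
  ∀ xs → countL r xs ≡ countL q xs → ∀ {x} → x ∈ xs → q x ≡ true → r x ≡ true
countL-saturated r⇒q (y ∷ ys) same x∈ qx
  with equal-parts (indicator-mono (r⇒q y)) (countL-mono r⇒q ys) same
... | head-same , tail-same with x∈
... | here refl = trans (indicator-injective head-same) qx
... | there x∈ys = countL-saturated r⇒q ys tail-same x∈ys qx

Extensional : ∀ {n} → (Coloring n → Bool) → Set
Extensional {n} p = ∀ {c d : Coloring n} → c ≈ d → p c ≡ p d

extend : ∀ {n} → Bool → Coloring n → Coloring (suc n)
extend b T F.zero = b
extend b T (F.suc i) = T i

subsets-complete : ∀ n (S : Coloring n) → Σ[ T ∈ Coloring n ] (T ∈ subsets n × S ≈ T)
subsets-complete zero S = _ , here refl , λ ()
subsets-complete (suc n) S with subsets-complete n (S ∘ F.suc) | S F.zero in eq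
... | T , T∈ , S≈T | false = _ , ∈-++⁺ˡ (∈-map⁺ _ T∈) , λ { F.zero → eq ; (F.suc i) → S≈T i }
... | T , T∈ , S≈T | true = _ , ∈-++⁺ʳ _ (∈-map⁺ _ T∈) , λ { F.zero → eq ; (F.suc i) → S≈T i }

countSets : ∀ n → (Coloring n → Bool) → ℕ
countSets n p = countL p (subsets n)

countSets-pos : ∀ n (p : Coloring n → Bool) → Extensional p → ∀ S → p S ≡ true → 1 ≤ countSets n p
countSets-pos n p ext-p S pS with subsets-complete n S
... | T , T∈ , S≈T = countL-pos p T∈ (trans (sym (ext-p S≈T)) pS)

countSets-saturated : ∀ n {r q : Coloring n → Bool} → Extensional r → Extensional q →
  (∀ S → r S ≡ true → q S ≡ true) → countSets n r ≡ countSets n q →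
  ∀ S → q S ≡ true → r S ≡ true
countSets-saturated n ext-r ext-q r⇒q same S qS with subsets-complete n S
... | T , T∈ , S≈T =
  trans (ext-r S≈T) (countL-saturated r⇒q (subsets n) same T∈ (trans (sym (ext-q S≈T)) qS))

countSets-split : ∀ n (p : Coloring (suc n) → Bool) → Extensional p →
  countSets (suc n) p ≡ countSets n (p ∘ extend false) + countSets n (p ∘ extend true)
countSets-split n p ext-p =
  trans (countL-++ p (map _ (subsets n)) (map _ (subsets n)))
        (cong₂ _+_ (half false _ (λ S → λ { F.zero → refl ; (F.suc i) → refl }))
                   (half true _ (λ S → λ { F.zero → refl ; (F.suc i) → refl })))
  where
  half : ∀ b (f : Coloring n → Coloring (suc n)) → (∀ S → f S ≈ extend b S) →
    countL p (map f (subsets n)) ≡ countSets n (p ∘ extend b)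
  half b f f≈ = trans (countL-map p f (subsets n)) (countL-ext (λ S → ext-p (f≈ S)) (subsets n))

⟦_⟧ : ∀ {n} → Permutation′ n → Fin n → Fin n
⟦ σ ⟧ = σ ⟨$⟩ʳ_

perm-suc : ∀ {n} (σ : Permutation′ (suc n)) k → ⟦ σ ⟧ (F.suc k) ≡ punchIn (⟦ σ ⟧ F.zero) (⟦ remove F.zero σ ⟧ k)
perm-suc σ k = punchIn-permute σ F.zero k

module +-Props = CommSemigroupProperties +-commutativeSemigroup
module ∨-Props = CommSemigroupProperties (CommutativeMonoid.commutativeSemigroup ∨-commutativeMonoid)

countV-punchIn : ∀ {n} (g : Fin (suc n) → Bool) j → countV g ≡ indicator (g j) + countV (g ∘ punchIn j)
countV-punchIn g F.zero = refl
countV-punchIn {suc n} g (F.suc j) =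
  trans (cong (indicator (g F.zero) +_) (countV-punchIn (g ∘ F.suc) j))
        (+-Props.x∙yz≈y∙xz (indicator (g F.zero)) (indicator (g (F.suc j))) _)

anyV-punchIn : ∀ {n} (g : Fin (suc n) → Bool) j → anyV g ≡ g j ∨ anyV (g ∘ punchIn j)
anyV-punchIn g F.zero = refl
anyV-punchIn {suc n} g (F.suc j) =
  trans (cong (g F.zero ∨_) (anyV-punchIn (g ∘ F.suc) j)) (∨-Props.x∙yz≈y∙xz (g F.zero) (g (F.suc j)) _)

countV-perm : ∀ n (σ : Permutation′ n) (g : Fin n → Bool) → countV (g ∘ ⟦ σ ⟧) ≡ countV g
countV-perm zero σ g = refl
countV-perm (suc n) σ g = trans (cong (indicator (g j) +_) rest) (sym (countV-punchIn g j))
  where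
  j : Fin (suc n)
  j = ⟦ σ ⟧ F.zero
  rest : countV (g ∘ ⟦ σ ⟧ ∘ F.suc) ≡ countV (g ∘ punchIn j)
  rest = trans (countV-ext (λ k → cong g (perm-suc σ k))) (countV-perm n (remove F.zero σ) (g ∘ punchIn j))

anyV-perm : ∀ n (σ : Permutation′ n) (g : Fin n → Bool) → anyV (g ∘ ⟦ σ ⟧) ≡ anyV g
anyV-perm zero σ g = refl
anyV-perm (suc n) σ g = trans (cong (g j ∨_) rest) (sym (anyV-punchIn g j))
  where
  j : Fin (suc n)
  j = ⟦ σ ⟧ F.zero
  rest : anyV (g ∘ ⟦ σ ⟧ ∘ F.suc) ≡ anyV (g ∘ punchIn j)
  rest = trans (anyV-ext (λ k → cong g (perm-suc σ k))) (anyV-perm n (remove F.zero σ) (g ∘ punchIn j))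

insertAt : ∀ {n} → Fin (suc n) → Bool → Coloring n → Coloring (suc n)
insertAt F.zero b T = extend b T
insertAt {suc n} (F.suc j) b T = extend (T F.zero) (insertAt j b (T ∘ F.suc))

insertAt-here : ∀ {n} (j : Fin (suc n)) b T → insertAt j b T j ≡ b
insertAt-here F.zero b T = refl
insertAt-here {suc n} (F.suc j) b T = insertAt-here j b (T ∘ F.suc)

insertAt-punchIn : ∀ {n} (j : Fin (suc n)) b T k → insertAt j b T (punchIn j k) ≡ T k
insertAt-punchIn F.zero b T k = refl
insertAt-punchIn {suc n} (F.suc j) b T F.zero = refl
insertAt-punchIn {suc n} (F.suc j) b T (F.suc k) = insertAt-punchIn j b (T ∘ F.suc) k

insertAt-ext : ∀ {n} (j : Fin (suc n)) b {c d : Coloring n} → c ≈ d → insertAt j b c ≈ insertAt j b d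
insertAt-ext F.zero b c≈d F.zero = refl
insertAt-ext F.zero b c≈d (F.suc x) = c≈d x
insertAt-ext {suc n} (F.suc j) b c≈d F.zero = c≈d F.zero
insertAt-ext {suc n} (F.suc j) b c≈d (F.suc x) = insertAt-ext j b (c≈d ∘ F.suc) x

extend-ext : ∀ {n} {p : Coloring (suc n) → Bool} → Extensional p → ∀ b → Extensional (p ∘ extend b)
extend-ext ext-p b c≈d = ext-p (λ { F.zero → refl ; (F.suc i) → c≈d i })

insertAt-extensional : ∀ {n} {p : Coloring (suc n) → Bool} → Extensional p → ∀ j b → Extensional (p ∘ insertAt j b)
insertAt-extensional ext-p j b c≈d = ext-p (insertAt-ext j b c≈d)

countSets-split-at : ∀ n (p : Coloring (suc n) → Bool) → Extensional p → ∀ j →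
  countSets (suc n) p ≡ countSets n (p ∘ insertAt j false) + countSets n (p ∘ insertAt j true)
countSets-split-at n p ext-p F.zero = countSets-split n p ext-p
countSets-split-at (suc n) p ext-p (F.suc j) = begin
  countSets (suc (suc n)) p
    ≡⟨ countSets-split (suc n) p ext-p ⟩
  countSets (suc n) (p ∘ extend false) + countSets (suc n) (p ∘ extend true)
    ≡⟨ cong₂ _+_ (countSets-split-at n _ (extend-ext ext-p false) j)
                 (countSets-split-at n _ (extend-ext ext-p true) j) ⟩
  (count false false + count false true) + (count true false + count true true)
    ≡⟨ +-Props.interchange (count false false) (count false true) (count true false) (count true true) ⟩
  (count false false + count true false) + (count false true + count true true)
    ≡⟨ sym (cong₂ _+_ (countSets-split n _ (insertAt-extensional ext-p (F.suc j) false))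
                      (countSets-split n _ (insertAt-extensional ext-p (F.suc j) true))) ⟩
  countSets (suc n) (p ∘ insertAt (F.suc j) false) + countSets (suc n) (p ∘ insertAt (F.suc j) true) ∎
  where
  open ≡-Reasoning
  count : Bool → Bool → ℕ
  count a b = countSets n (λ T → p (extend a (insertAt j b T)))

countSets-perm : ∀ n (σ : Permutation′ n) (p : Coloring n → Bool) → Extensional p →
  countSets n (λ S → p (S ∘ ⟦ σ ⟧)) ≡ countSets n p
countSets-perm zero σ p ext-p = cong (λ b → indicator b + 0) (ext-p (λ ()))
countSets-perm (suc n) σ p ext-p = begin
  countSets (suc n) q
    ≡⟨ countSets-split-at n q (λ c≈d → ext-p (c≈d ∘ ⟦ σ ⟧)) j ⟩
  countSets n (q ∘ insertAt j false) + countSets n (q ∘ insertAt j true)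
    ≡⟨ cong₂ _+_ (relabel false) (relabel true) ⟩
  countSets n (p ∘ extend false) + countSets n (p ∘ extend true)
    ≡⟨ sym (countSets-split n p ext-p) ⟩
  countSets (suc n) p ∎
  where
  open ≡-Reasoning
  j : Fin (suc n)
  j = ⟦ σ ⟧ F.zero
  τ : Permutation′ n
  τ = remove F.zero σ
  q : Coloring (suc n) → Bool
  q S = p (S ∘ ⟦ σ ⟧)
  moved : ∀ b T → q (insertAt j b T) ≡ p (extend b (T ∘ ⟦ τ ⟧))
  moved b T = ext-p λ { F.zero → insertAt-here j b T
                      ; (F.suc k) → trans (cong (insertAt j b T) (perm-suc σ k)) (insertAt-punchIn j b T _) }
  relabel : ∀ b → countSets n (q ∘ insertAt j b) ≡ countSets n (p ∘ extend b)
  relabel b = trans (countL-ext (moved b) (subsets n)) (countSets-perm n τ (p ∘ extend b) (extend-ext ext-p b))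

hasSize : ∀ {n} → ℕ → Coloring n → Bool
hasSize i S = does (countV S ℕ.≟ i)

zfsOfSize : ∀ {n} → Graph n → ℕ → Coloring n → Bool
zfsOfSize G i S = hasSize i S ∧ isZFS G S

hasSize-sound : ∀ {n} i (S : Coloring n) → hasSize i S ≡ true → countV S ≡ i
hasSize-sound i S e = invert (subst (Reflects (countV S ≡ i)) e (proof (countV S ℕ.≟ i)))

zfsOfSize-ext : ∀ {n} (G : Graph n) i → Extensional (zfsOfSize G i)
zfsOfSize-ext G i c≈d rewrite countV-ext c≈d | isZFS-ext G c≈d = refl

z-count : ∀ {n} (G : Graph n) i → z G i ≡ countSets n (zfsOfSize G i)
z-count {n} G i =
  trans (length-filter (λ S → (countV S ℕ.≟ i) ×-dec (isZFS G S B.≟ true)) (subsets n))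
        (countL-ext (λ S → cong (hasSize i S ∧_) (does-≟-true (isZFS G S))) (subsets n))
  where
  does-≟-true : ∀ b → does (b B.≟ true) ≡ b
  does-≟-true false = refl
  does-≟-true true = refl

module Isomorphism {n} (G H : Graph n) (σ : Permutation′ n)
  (iso : ∀ u v → adj G u v ≡ adj H (⟦ σ ⟧ u) (⟦ σ ⟧ v)) where

  forces-iso : ∀ c u x → forces G (c ∘ ⟦ σ ⟧) u x ≡ forces H c (⟦ σ ⟧ u) (⟦ σ ⟧ x)
  forces-iso c u x rewrite iso u x
    | countV-ext (λ w → cong (_∧ not (c (⟦ σ ⟧ w))) (iso u w))
    | countV-perm n σ (uncoloured H c (⟦ σ ⟧ u)) = refl

  step-iso : ∀ c x → step G (c ∘ ⟦ σ ⟧) x ≡ step H c (⟦ σ ⟧ x)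
  step-iso c x = cong (c (⟦ σ ⟧ x) ∨_)
    (trans (anyV-ext (λ u → forces-iso c u x)) (anyV-perm n σ (λ u → forces H c u (⟦ σ ⟧ x))))

  iter-iso : ∀ m c x → iter m G (c ∘ ⟦ σ ⟧) x ≡ iter m H c (⟦ σ ⟧ x)
  iter-iso zero c x = refl
  iter-iso (suc m) c x = trans (iter-ext m G (step-iso c) x) (iter-iso m (step H c) x)

  isZFS-iso : ∀ S → isZFS G (S ∘ ⟦ σ ⟧) ≡ isZFS H S
  isZFS-iso S = cong not (trans (anyV-ext (λ v → cong not (iter-iso n S v)))
                               (anyV-perm n σ (λ v → not (closure H S v))))

  z-iso : ∀ i → z G i ≡ z H i
  z-iso i = begin
    z G i                                               ≡⟨ z-count G i ⟩
    countSets n (zfsOfSize G i)                         ≡⟨ sym (countSets-perm n σ _ (zfsOfSize-ext G i)) ⟩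
    countSets n (λ S → zfsOfSize G i (S ∘ ⟦ σ ⟧))        ≡⟨ countL-ext relabel (subsets n) ⟩
    countSets n (zfsOfSize H i)                         ≡⟨ sym (z-count H i) ⟩
    z H i                                               ∎
    where
    open ≡-Reasoning
    relabel : ∀ S → zfsOfSize G i (S ∘ ⟦ σ ⟧) ≡ zfsOfSize H i S
    relabel S rewrite isZFS-iso S | countV-perm n σ S = refl

iso⇒ZPolyEq : ∀ {n} (G H : Graph n) → G ≃G H → ZPolyEq G H
iso⇒ZPolyEq G H (σ , iso) i _ _ = Isomorphism.z-iso G H σ iso i

all-sets-zfs : ∀ {n} (G : Graph n) i → z G i ≡ countSets n (hasSize i) →
  ∀ S → countV S ≡ i → isZFS G S ≡ true
all-sets-zfs {n} G i z≡ S |S| =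
  ∧-conicalʳ (hasSize i S) _
    (countSets-saturated n (zfsOfSize-ext G i) size-ext (λ T → ∧-conicalˡ _ _)
      (trans (sym (z-count G i)) z≡) S (dec-true (countV S ℕ.≟ i) |S|))
  where
  size-ext : Extensional (hasSize {n} i)
  size-ext c≈d rewrite countV-ext c≈d = refl

zfs⇒z-pos : ∀ {n} (G : Graph n) i S → countV S ≡ i → isZFS G S ≡ true → 1 ≤ z G i
zfs⇒z-pos {n} G i S |S| zfs =
  subst (1 ≤_) (sym (z-count G i))
    (countSets-pos n (zfsOfSize G i) (zfsOfSize-ext G i) S (both (dec-true (countV S ℕ.≟ i) |S|) zfs))

complement-size : ∀ {n} (S : Coloring n) {a b} → countV S ≡ a → a + b ≡ n → countV (not ∘ S) ≡ b
complement-size S {a} |S| a+b =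
  +-cancelˡ-≡ a _ _ (trans (cong (_+ _) (sym |S|)) (trans (countV-compl S) (sym a+b)))

K-uncoloured : ∀ {n} (c : Coloring n) u → c u ≡ true → ∀ t → uncoloured (K n) c u t ≡ not (c t)
K-uncoloured c u cu t with u F.≟ t
... | yes refl rewrite cu = refl
... | no _ = refl

K-one-uncoloured : ∀ {n} (S : Coloring n) u → S u ≡ true → countV (not ∘ S) ≡ 1 → isZFS (K n) S ≡ true
K-one-uncoloured {suc n} S u Su one with countV-one (not ∘ S) one
... | v , S̄v , only-v = zfs-within (K (suc n)) S 1 (s≤s z≤n) coloured
  where
  coloured : ∀ x → step (K (suc n)) S x ≡ true
  coloured x = step-if-uncoloured (K (suc n)) S x λ Sx → subst (λ y → step (K (suc n)) S y ≡ true)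
    (sym (only-v x (cong not Sx)))
    (step-force (K (suc n)) S u v Su (trans (K-uncoloured S u Su v) S̄v) (trans (countV-ext (K-uncoloured S u Su)) one))

-- In K_n, with two uncoloured vertices every coloured vertex sees both, so
-- nothing is ever forced.
K-two-uncoloured : ∀ {n} (S : Coloring n) → countV (not ∘ S) ≡ 2 → isZFS (K n) S ≡ false
K-two-uncoloured {n} S two with isZFS (K n) S in zfs
... | false = refl
... | true with countV-witness (not ∘ S) (subst (1 ≤_) (sym two) (s≤s z≤n))
... | v , S̄v = ⊥-elim (true≢false (trans (sym (stable-zfs (K n) S stable zfs v)) (not-true S̄v)))
  where
  unforced : ∀ y u → forces (K n) S u y ≡ false
  unforced y u with forces (K n) S u y in f
  ... | false = refl
  ... | true with forces-inv (K n) S u y f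
  ... | Su , _ , one with () ← trans (sym one) (trans (countV-ext (K-uncoloured S u Su)) two)
  stable : step (K n) S ≈ S
  stable y = step-unforced (K n) S y (unforced y)

allBut : ∀ {n} → Fin n → Coloring n
allBut v t = not (t is v)

-- If V ∖ {v} is a zero forcing set then v has a neighbour: an isolated
-- vertex can never be forced.
allBut-zfs⇒neighbour : ∀ {n} (G : Graph n) v → isZFS G (allBut v) ≡ true → Σ[ x ∈ Fin n ] adj G x v ≡ true
allBut-zfs⇒neighbour {n} G v zfs with anyV (λ x → adj G x v) in some
... | true = anyV-witness _ some
... | false = ⊥-elim (true≢false (begin
  true                      ≡⟨ sym (isZFS-sound G (allBut v) zfs v) ⟩
  closure G (allBut v) v    ≡⟨ iter-frozen n G v frozen (allBut v) ⟩
  not (v is v)              ≡⟨ cong not (⌊⌋-yes (v F.≟ v) refl) ⟩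
  false                     ∎))
  where
  open ≡-Reasoning
  frozen : ∀ c → step G c v ≡ c v
  frozen c = step-unforced G c v λ u → no-edge (anyV-false _ some u)
    where
    no-edge : ∀ {u} → adj G u v ≡ false → forces G c u v ≡ false
    no-edge {u} uv rewrite uv = ∧-zeroʳ (c u)

two-vertices : ∀ {n} (u v : Fin n) → u ≢ v → 2 ≤ n
two-vertices {suc zero} F.zero F.zero u≢v = ⊥-elim (u≢v refl)
two-vertices {suc (suc n)} u v u≢v = s≤s (s≤s z≤n)

adj⇒≢ : ∀ {n} (G : Graph n) {a b} → adj G a b ≡ true → a ≢ b
adj⇒≢ G {a} ab refl = true≢false (trans (sym ab) (loopless G a))

-- If u ≁ v are distinct, w ~ u and x ~ v, then V ∖ {w, v} is a zero forcing
-- set of G: first w is the only uncoloured neighbour of u, and afterwards v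
-- is the only uncoloured neighbour of x.
module NonAdjacent {n} (G : Graph n) {u v w x : Fin n} (u≢v : u ≢ v) (u≁v : adj G u v ≡ false)
                   (w~u : adj G w u ≡ true) (x~v : adj G x v ≡ true) where

  S : Coloring n
  S t = not ((t is w) ∨ (t is v))

  u~w : adj G u w ≡ true
  u~w = trans (symm G u w) w~u

  w≢v : w ≢ v
  w≢v refl = true≢false (trans (sym u~w) u≁v)

  S-omits-two : countV (λ t → (t is w) ∨ (t is v)) ≡ 2
  S-omits-two = begin
    countV (λ t → (t is w) ∨ (t is v))              ≡⟨ countV-insert (_is w) v (⌊⌋-no (v F.≟ w) (w≢v ∘ sym)) ⟩
    suc (countV (_is w))                            ≡⟨ cong suc (countV-singleton w) ⟩
    2                                               ∎
    where open ≡-Reasoning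

  S-coloured : ∀ t → t ≢ w → t ≢ v → S t ≡ true
  S-coloured t t≢w t≢v rewrite ⌊⌋-no (t F.≟ w) t≢w | ⌊⌋-no (t F.≟ v) t≢v = refl

  Su : S u ≡ true
  Su = S-coloured u (adj⇒≢ G u~w) u≢v

  Sw : S w ≡ false
  Sw rewrite ⌊⌋-yes (w F.≟ w) refl = refl

  round₁ : ∀ t → t ≢ v → step G S t ≡ true
  round₁ t t≢v = by-cases (t F.≟ w)
    where
    others : ∀ t → t ≢ w → uncoloured G S u t ≡ false
    others t t≢w = by-v (t F.≟ v)
      where
      by-v : Dec (t ≡ v) → uncoloured G S u t ≡ false
      by-v (yes refl) = cong (_∧ not (S v)) u≁v
      by-v (no t≢v) rewrite S-coloured t t≢w t≢v = ∧-zeroʳ (adj G u t)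
    by-cases : Dec (t ≡ w) → step G S t ≡ true
    by-cases (no t≢w) = step-mono G S t (S-coloured t t≢w t≢v)
    by-cases (yes refl) = step-force-sole G S u w Su u~w Sw others

  round₂ : ∀ t → step G (step G S) t ≡ true
  round₂ t = by-cases (t F.≟ v)
    where
    others : ∀ t → t ≢ v → uncoloured G (step G S) x t ≡ false
    others t t≢v rewrite round₁ t t≢v = ∧-zeroʳ (adj G x t)
    by-cases : Dec (t ≡ v) → step G (step G S) t ≡ true
    by-cases (no t≢v) = step-mono G (step G S) t (round₁ t t≢v)
    by-cases (yes refl) = step-if-uncoloured G (step G S) v λ c₁v →
      step-force-sole G (step G S) x v (round₁ x (adj⇒≢ G x~v)) x~v c₁v others

  S-size : ∀ {m} → m + 2 ≡ n → countV S ≡ m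
  S-size m+2 = complement-size (λ t → (t is w) ∨ (t is v)) S-omits-two (trans (+-comm 2 _) m+2)

  zfs : isZFS G S ≡ true
  zfs = zfs-within G S 2 (two-vertices u v u≢v) round₂

z-K-large : ∀ m → z (K (suc (suc m))) (suc m) ≡ countSets (suc (suc m)) (hasSize (suc m))
z-K-large m = trans (z-count (K n) (suc m)) (countL-ext large-zfs (subsets n))
  where
  n : ℕ
  n = suc (suc m)
  large-is-zfs : ∀ S → countV S ≡ suc m → isZFS (K n) S ≡ true
  large-is-zfs S |S| =
    let u , Su = countV-witness S (subst (1 ≤_) (sym |S|) (s≤s z≤n))
    in K-one-uncoloured S u Su (complement-size S |S| (+-comm (suc m) 1))
  large-zfs : ∀ S → zfsOfSize (K n) (suc m) S ≡ hasSize (suc m) S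
  large-zfs S = ∧-redundant (hasSize (suc m) S) (λ e → large-is-zfs S (hasSize-sound (suc m) S e))

z-K-small : ∀ m → z (K (suc (suc m))) m ≡ 0
z-K-small m = trans (z-count (K n) m) (countL-none _ small-not-zfs (subsets n))
  where
  n : ℕ
  n = suc (suc m)
  small-not-zfs : ∀ S → zfsOfSize (K n) m S ≡ false
  small-not-zfs S = ∧-refuted (hasSize m S) λ e →
    K-two-uncoloured S (complement-size S (hasSize-sound m S e) (+-comm m 2))

-- A graph with the zero forcing polynomial of K_n is complete: every
-- (n-1)-set is zero forcing, so there is no isolated vertex, and a
-- non-adjacent pair would yield a zero forcing set of size n-2.
ZPolyEq-K⇒complete : ∀ n (G : Graph n) → ZPolyEq G (K n) → ∀ u v → u ≢ v → adj G u v ≡ true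
ZPolyEq-K⇒complete (suc zero) G same F.zero F.zero u≢v = ⊥-elim (u≢v refl)
ZPolyEq-K⇒complete (suc (suc m)) G same u v u≢v = not-false⇒true (adj G u v) nonadjacent-impossible
  where
  n : ℕ
  n = suc (suc m)
  neighbour : ∀ y → Σ[ t ∈ Fin n ] adj G t y ≡ true
  neighbour y = allBut-zfs⇒neighbour G y
    (all-sets-zfs G (suc m) (trans (same (suc m) (s≤s z≤n) (n≤1+n (suc m))) (z-K-large m)) (allBut y)
      (complement-size (_is y) (countV-singleton y) refl))
  nonadjacent-impossible : adj G u v ≡ false → ⊥
  nonadjacent-impossible u≁v = 1+n≰n (begin
    1           ≤⟨ zfs⇒z-pos G m NA.S |S| NA.zfs ⟩
    z G m       ≡⟨ same m size-pos (≤-trans (n≤1+n m) (n≤1+n (suc m))) ⟩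
    z (K n) m   ≡⟨ z-K-small m ⟩
    0           ∎)
    where
    open ≤-Reasoning
    module NA = NonAdjacent G u≢v u≁v (proj₂ (neighbour u)) (proj₂ (neighbour v))
    |S| : countV NA.S ≡ m
    |S| = NA.S-size (+-comm m 2)
    size-pos : 1 ≤ m
    size-pos = subst (1 ≤_) |S| (countV-pos NA.S u NA.Su)

complete⇒≃K : ∀ {n} (G : Graph n) → (∀ u v → u ≢ v → adj G u v ≡ true) → G ≃G K n
complete⇒≃K {n} G complete = Perm.id , same-edges
  where
  same-edges : ∀ u v → adj G u v ≡ adj (K n) u v
  same-edges u v with u F.≟ v
  ... | yes refl = loopless G u
  ... | no u≢v = complete u v u≢v

-- Adjacency of P_n in terms of positions: i ~ j iff |i - j| = 1; by
-- definition adj (P n) a b is pathAdj (toℕ a) (toℕ b).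
pathAdj : ℕ → ℕ → Bool
pathAdj i j = ⌊ suc i ℕ.≟ j ⌋ ∨ ⌊ suc j ℕ.≟ i ⌋

pathAdj-sym : ∀ i j → pathAdj i j ≡ pathAdj j i
pathAdj-sym i j = ∨-comm ⌊ suc i ℕ.≟ j ⌋ _

pathAdj-next : ∀ k → pathAdj k (suc k) ≡ true
pathAdj-next k rewrite ⌊⌋-yes (suc k ℕ.≟ suc k) refl = refl

pathAdj-apart : ∀ {i j} → suc i ≢ j → suc j ≢ i → pathAdj i j ≡ false
pathAdj-apart {i} {j} i+1≢j j+1≢i rewrite ⌊⌋-no (suc i ℕ.≟ j) i+1≢j | ⌊⌋-no (suc j ℕ.≟ i) j+1≢i = refl

pathAdj-loop : ∀ i → pathAdj i i ≡ false
pathAdj-loop i = pathAdj-apart {i} {i} 1+n≢n 1+n≢n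

pathAdj-far : ∀ {j k} → j < k → pathAdj (suc k) j ≡ false
pathAdj-far {j} {k} j<k =
  pathAdj-apart (λ e → <⇒≱ j<k (≤-trans (n≤1+n k) (≤-trans (n≤1+n (suc k)) (≤-reflexive e))))
                (λ e → <⇒≢ j<k (suc-injective e))

-- In P_n, once the first k+1 vertices are coloured, vertex k forces vertex
-- k+1; hence the colouring sweeps along the path one vertex per round.
module PathSweep (n : ℕ) where

  Prefix : Coloring n → ℕ → Set
  Prefix c k = ∀ x → toℕ x ≤ k → c x ≡ true

  sweep-step : ∀ c k → Prefix c k → suc k < n → Prefix (step (P n) c) (suc k)
  sweep-step c k pre k+1<n x x≤k+1 with m≤n⇒m<n∨m≡n x≤k+1
  ... | inj₁ (s≤s x≤k) = step-mono (P n) c x (pre x x≤k)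
  ... | inj₂ x≡k+1 = step-if-uncoloured (P n) c x λ cx →
        step-force-sole (P n) c u x (pre u (≤-reflexive u≡k)) u~x cx others
    where
    k<n : k < n
    k<n = ≤-trans (n≤1+n (suc k)) k+1<n
    u : Fin n
    u = fromℕ< k<n
    u≡k : toℕ u ≡ k
    u≡k = toℕ-fromℕ< k<n
    u~x : adj (P n) u x ≡ true
    u~x = trans (cong₂ pathAdj u≡k x≡k+1) (pathAdj-next k)
    others : ∀ t → t ≢ x → uncoloured (P n) c u t ≡ false
    others t t≢x with toℕ t ℕ.≤? k
    ... | yes t≤k rewrite pre t t≤k = ∧-zeroʳ _
    ... | no t≰k = cong (_∧ not (c t)) (trans (cong (λ i → pathAdj i (toℕ t)) u≡k)
                     (pathAdj-apart (λ e → t≢x (toℕ-injective (trans (sym e) (sym x≡k+1))))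
                                    (λ e → t≰k (≤-trans (n≤1+n (toℕ t)) (≤-reflexive e)))))

  sweep : ∀ j c k → Prefix c k → Prefix (iter j (P n) c) (k + j)
  sweep zero c k pre x x≤k = pre x (subst (toℕ x ≤_) (+-identityʳ k) x≤k)
  sweep (suc j) c k pre x x≤k+j+1 with suc k ℕ.<? n
  ... | yes k+1<n = sweep j (step (P n) c) (suc k) (sweep-step c k pre k+1<n) x (subst (toℕ x ≤_) (+-suc k j) x≤k+j+1)
  ... | no k+1≮n = iter-mono (suc j) (P n) c x (pre x (ℕ.s≤s⁻¹ (≤-trans (toℕ<n x) (≮⇒≥ k+1≮n))))

z-P-one : ∀ n → 1 ≤ z (P (suc n)) 1
z-P-one n = zfs⇒z-pos (P (suc n)) 1 (_is F.zero) (countV-singleton {suc n} F.zero)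
  (zfs-within (P (suc n)) (_is F.zero) (suc n) ≤-refl
    (λ x → sweep (suc n) (_is F.zero) 0 endpoint x (<⇒≤ (toℕ<n x))))
  where
  open PathSweep (suc n)
  endpoint : Prefix (_is F.zero) 0
  endpoint F.zero _ = ⌊⌋-yes (F._≟_ {suc n} F.zero F.zero) refl
  endpoint (F.suc x) ()

-- A chain
-- w₀, …, wₖ records the coloured vertices in the order they were coloured;
-- the invariant says they are exactly the coloured vertices, they induce a
-- path in this order, and all of w₀, …, wₖ₋₁ have no uncoloured neighbour.
module ForcingChain {n} (G : Graph n) where

  record Chain (k : ℕ) (w : ℕ → Fin n) (c : Coloring n) : Set where
    field
      coloured : ∀ i → i ≤ k → c (w i) ≡ true
      covers : ∀ x → c x ≡ true → Σ[ i ∈ ℕ ] (i ≤ k × w i ≡ x)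
      injective : ∀ i j → i ≤ k → j ≤ k → w i ≡ w j → i ≡ j
      induced-path : ∀ i j → i ≤ k → j ≤ k → adj G (w i) (w j) ≡ pathAdj i j
      saturated : ∀ i → i < k → ∀ x → adj G (w i) x ≡ true → c x ≡ true
      size : countV c ≡ suc k

  chain-ext : ∀ {k w c d} → Chain k w c → c ≈ d → Chain k w d
  chain-ext {w = w} I c≈d = record
    { coloured = λ i i≤k → trans (sym (c≈d (w i))) (coloured i i≤k)
    ; covers = λ x dx → covers x (trans (c≈d x) dx)
    ; injective = injective
    ; induced-path = induced-path
    ; saturated = λ i i<k x w~x → trans (sym (c≈d x)) (saturated i i<k x w~x)
    ; size = trans (sym (countV-ext c≈d)) size }
    where open Chain I

  chain-start : ∀ S → countV S ≡ 1 → Σ[ w ∈ (ℕ → Fin n) ] Chain 0 w S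
  chain-start S one with countV-one S one
  ... | v , Sv , only-v = (λ _ → v) , record
    { coloured = λ _ _ → Sv
    ; covers = λ x Sx → 0 , z≤n , sym (only-v x Sx)
    ; injective = λ { 0 0 z≤n z≤n _ → refl }
    ; induced-path = λ { 0 0 z≤n z≤n → loopless G v }
    ; saturated = λ i ()
    ; size = one }

  only-tip-forces : ∀ {k w c} → Chain k w c → ∀ u t → forces G c u t ≡ true →
    u ≡ w k × uncoloured G c u t ≡ true × countV (uncoloured G c u) ≡ 1
  only-tip-forces {c = c} I u t u⇒t with forces-inv G c u t u⇒t
  ... | cu , ut , one with Chain.covers I u cu
  ... | i , i≤k , refl with m≤n⇒m<n∨m≡n i≤k
  ... | inj₂ refl = refl , ut , one
  ... | inj₁ i<k = ⊥-elim (true≢false (trans (sym (Chain.saturated I i i<k t (∧-conicalˡ _ _ ut)))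
                                            (not-true (∧-conicalʳ _ _ ut))))

  chain-stuck : ∀ {k w c} → Chain k w c → countV (uncoloured G c (w k)) ≢ 1 → step G c ≈ c
  chain-stuck {c = c} I not-one t = step-unforced G c t unforced
    where
    unforced : ∀ u → forces G c u t ≡ false
    unforced u with forces G c u t in u⇒t
    ... | false = refl
    ... | true with only-tip-forces I u t u⇒t
    ... | refl , _ , one = ⊥-elim (not-one one)

  module Extend {k : ℕ} {w : ℕ → Fin n} {c : Coloring n} (I : Chain k w c)
    {y : Fin n} (tip~y : uncoloured G c (w k) y ≡ true)
    (only-y : ∀ t → uncoloured G c (w k) t ≡ true → t ≡ y) where

    open Chain I

    one : countV (uncoloured G c (w k)) ≡ 1
    one = trans (countV-ext sole) (countV-singleton y)
      where
      sole : ∀ t → uncoloured G c (w k) t ≡ (t is y)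
      sole t with uncoloured G c (w k) t in tt | t F.≟ y
      ... | true | yes _ = refl
      ... | true | no t≢y = ⊥-elim (t≢y (only-y t tt))
      ... | false | no _ = refl
      ... | false | yes refl = trans (sym tt) tip~y

    c' : Coloring n
    c' t = c t ∨ (t is y)

    cy : c y ≡ false
    cy = not-true (∧-conicalʳ _ _ tip~y)

    c'y : c' y ≡ true
    c'y rewrite ⌊⌋-yes (y F.≟ y) refl = ∨-zeroʳ (c y)

    c'-old : ∀ {x} → c x ≡ true → c' x ≡ true
    c'-old cx rewrite cx = refl

    next-round : step G c ≈ c'
    next-round t with t F.≟ y
    ... | yes refl = trans (step-force G c (w k) y (coloured k ≤-refl) tip~y one) (sym (∨-zeroʳ (c y)))
    ... | no t≢y = trans (step-unforced G c t unforced) (sym (∨-identityʳ (c t)))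
      where
      unforced : ∀ u → forces G c u t ≡ false
      unforced u with forces G c u t in u⇒t
      ... | false = refl
      ... | true with only-tip-forces I u t u⇒t
      ... | refl , ut , _ = ⊥-elim (t≢y (only-y t ut))

    w' : ℕ → Fin n
    w' j = if ⌊ j ℕ.≟ suc k ⌋ then y else w j

    w'-old : ∀ {j} → j ≤ k → w' j ≡ w j
    w'-old {j} j≤k rewrite ⌊⌋-no (j ℕ.≟ suc k) (λ e → 1+n≰n (subst (_≤ k) e j≤k)) = refl

    w'-new : w' (suc k) ≡ y
    w'-new rewrite ⌊⌋-yes (suc k ℕ.≟ suc k) refl = refl

    old-or-new : ∀ {i} → i ≤ suc k → i ≤ k ⊎ i ≡ suc k
    old-or-new i≤k+1 with m≤n⇒m<n∨m≡n i≤k+1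
    ... | inj₁ (s≤s i≤k) = inj₁ i≤k
    ... | inj₂ i≡k+1 = inj₂ i≡k+1

    y-new : ∀ {i} → i ≤ k → w i ≢ y
    y-new i≤k wi≡y = true≢false (trans (sym (coloured _ i≤k)) (trans (cong c wi≡y) cy))

    y-only-after-tip : ∀ {i} → i < k → adj G (w i) y ≡ false
    y-only-after-tip {i} i<k with adj G (w i) y in wi~y
    ... | false = refl
    ... | true = ⊥-elim (true≢false (trans (sym (saturated i i<k y wi~y)) cy))

    coloured' : ∀ i → i ≤ suc k → c' (w' i) ≡ true
    coloured' i i≤k+1 with old-or-new i≤k+1
    ... | inj₁ i≤k rewrite w'-old i≤k = c'-old (coloured i i≤k)
    ... | inj₂ refl rewrite w'-new = c'y

    covers' : ∀ x → c' x ≡ true → Σ[ i ∈ ℕ ] (i ≤ suc k × w' i ≡ x)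
    covers' x c'x with c x in cx | x F.≟ y
    ... | true | _ with covers x cx
    ...   | i , i≤k , wi≡x = i , ≤-trans i≤k (n≤1+n k) , trans (w'-old i≤k) wi≡x
    covers' x c'x | false | yes refl = suc k , ≤-refl , w'-new
    covers' x () | false | no _

    injective' : ∀ i j → i ≤ suc k → j ≤ suc k → w' i ≡ w' j → i ≡ j
    injective' i j i≤ j≤ e with old-or-new i≤ | old-or-new j≤
    ... | inj₁ i≤k | inj₁ j≤k = injective i j i≤k j≤k (trans (sym (w'-old i≤k)) (trans e (w'-old j≤k)))
    ... | inj₂ refl | inj₂ refl = refl
    ... | inj₁ i≤k | inj₂ refl = ⊥-elim (y-new i≤k (trans (sym (w'-old i≤k)) (trans e w'-new)))
    ... | inj₂ refl | inj₁ j≤k = ⊥-elim (y-new j≤k (trans (sym (w'-old j≤k)) (trans (sym e) w'-new)))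

    old-to-new : ∀ i → i ≤ k → adj G (w i) y ≡ pathAdj i (suc k)
    old-to-new i i≤k with m≤n⇒m<n∨m≡n i≤k
    ... | inj₁ i<k = trans (y-only-after-tip i<k)
                           (sym (trans (pathAdj-sym i (suc k)) (pathAdj-far i<k)))
    ... | inj₂ refl = trans (∧-conicalˡ _ _ tip~y) (sym (pathAdj-next k))

    induced-path' : ∀ i j → i ≤ suc k → j ≤ suc k → adj G (w' i) (w' j) ≡ pathAdj i j
    induced-path' i j i≤ j≤ with old-or-new i≤ | old-or-new j≤
    ... | inj₁ i≤k | inj₁ j≤k rewrite w'-old i≤k | w'-old j≤k = induced-path i j i≤k j≤k
    ... | inj₂ refl | inj₂ refl rewrite w'-new = trans (loopless G y) (sym (pathAdj-loop (suc k)))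
    ... | inj₁ i≤k | inj₂ refl rewrite w'-old i≤k | w'-new = old-to-new i i≤k
    ... | inj₂ refl | inj₁ j≤k rewrite w'-old j≤k | w'-new =
      trans (symm G y (w j)) (trans (old-to-new j j≤k) (pathAdj-sym j (suc k)))

    saturated' : ∀ i → i < suc k → ∀ x → adj G (w' i) x ≡ true → c' x ≡ true
    saturated' i (s≤s i≤k) x wi~x = by-colour (c x) refl
      where
      wi~x' : adj G (w i) x ≡ true
      wi~x' = subst (λ z → adj G z x ≡ true) (w'-old i≤k) wi~x
      by-colour : ∀ b → c x ≡ b → c' x ≡ true
      by-colour true cx = c'-old cx
      by-colour false cx with m≤n⇒m<n∨m≡n i≤k
      ... | inj₁ i<k = ⊥-elim (true≢false (trans (sym (saturated i i<k x wi~x')) cx))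
      ... | inj₂ refl = subst (λ z → c' z ≡ true) (sym (only-y x (both wi~x' (cong not cx)))) c'y

    extended : Chain (suc k) w' (step G c)
    extended = chain-ext (record
      { coloured = coloured' ; covers = covers' ; injective = injective'
      ; induced-path = induced-path' ; saturated = saturated'
      ; size = trans (countV-insert c y cy) (cong suc size) })
      (λ t → sym (next-round t))

  CompleteChain : Set
  CompleteChain = Σ[ k ∈ ℕ ] Σ[ w ∈ (ℕ → Fin n) ] Σ[ c ∈ Coloring n ] (Chain k w c × (∀ x → c x ≡ true))

  -- Following the process: while the tip forces, the chain grows; once it
  -- stops the colouring is final, so if the process colours every vertex the
  -- chain contains every vertex.
  run : ∀ m {k w c} → Chain k w c → (∀ x → iter m G c x ≡ true) → CompleteChain
  run zero I all = _ , _ , _ , I , all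
  run (suc m) {k} {w} {c} I all with countV (uncoloured G c (w k)) ℕ.≟ 1
  ... | yes one with countV-one _ one
  ...   | y , tip~y , only-y = run m (Extend.extended I tip~y only-y) all
  run (suc m) {k} {w} {c} I all | no not-one =
    _ , _ , _ , I , λ x → trans (sym (iter-stable (suc m) G c (chain-stuck I not-one) x)) (all x)

  complete-chain⇒≃P : CompleteChain → G ≃G P n
  complete-chain⇒≃P (k , w , c , I , all) = permutation to from to∘from from∘to , preserves
    where
    open Chain I
    k+1≡n : suc k ≡ n
    k+1≡n = trans (sym size) (countV-all c all)
    position : Fin n → ℕ
    position x = proj₁ (covers x (all x))
    position≤k : ∀ x → position x ≤ k
    position≤k x = proj₁ (proj₂ (covers x (all x)))
    at-position : ∀ x → w (position x) ≡ x
    at-position x = proj₂ (proj₂ (covers x (all x)))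
    position<n : ∀ x → position x < n
    position<n x = subst (position x <_) k+1≡n (s≤s (position≤k x))
    to : Fin n → Fin n
    to x = fromℕ< (position<n x)
    from : Fin n → Fin n
    from j = w (toℕ j)
    toℕ-to : ∀ x → toℕ (to x) ≡ position x
    toℕ-to x = toℕ-fromℕ< (position<n x)
    from∘to : ∀ x → from (to x) ≡ x
    from∘to x = trans (cong w (toℕ-to x)) (at-position x)
    to∘from : ∀ j → to (from j) ≡ j
    to∘from j = toℕ-injective (trans (toℕ-to (from j))
      (injective _ _ (position≤k (from j)) (ℕ.s≤s⁻¹ (subst (toℕ j <_) (sym k+1≡n) (toℕ<n j))) (at-position (from j))))
    preserves : ∀ u v → adj G u v ≡ adj (P n) (to u) (to v)
    preserves u v = begin
      adj G u v                                     ≡⟨ sym (cong₂ (adj G) (at-position u) (at-position v)) ⟩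
      adj G (w (position u)) (w (position v))       ≡⟨ induced-path _ _ (position≤k u) (position≤k v) ⟩
      pathAdj (position u) (position v)             ≡⟨ sym (cong₂ pathAdj (toℕ-to u) (toℕ-to v)) ⟩
      adj (P n) (to u) (to v)                       ∎
      where open ≡-Reasoning

zfs-one⇒≃P : ∀ {n} (G : Graph n) S → countV S ≡ 1 → isZFS G S ≡ true → G ≃G P n
zfs-one⇒≃P {n} G S one zfs = complete-chain⇒≃P (run n (proj₂ (chain-start S one)) (isZFS-sound G S zfs))
  where open ForcingChain G

z-pos⇒zfs : ∀ {n} (G : Graph n) i → 1 ≤ z G i → Σ[ S ∈ Coloring n ] (countV S ≡ i × isZFS G S ≡ true)
z-pos⇒zfs {n} G i pos =
  let S , S-zfs = countL-witness (zfsOfSize G i) (subsets n) (subst (1 ≤_) (z-count G i) pos)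
  in S , hasSize-sound i S (∧-conicalˡ _ _ S-zfs) , ∧-conicalʳ (hasSize i S) _ S-zfs

ZPolyEq-P⇒≃P : ∀ n (G : Graph (suc n)) → ZPolyEq G (P (suc n)) → G ≃G P (suc n)
ZPolyEq-P⇒≃P n G same =
  let S , one , zfs = z-pos⇒zfs G 1 (subst (1 ≤_) (sym (same 1 ≤-refl (s≤s z≤n))) (z-P-one n))
  in zfs-one⇒≃P G S one zfs

proposition5p8 : (n : ℕ) → 1 ≤ n → (G : Graph n) →
    ((ZPolyEq G (P n) ⇔ (G ≃G P n)) × (ZPolyEq G (K n) ⇔ (G ≃G K n)))
proposition5p8 (suc n) _ G =
  mk⇔ (ZPolyEq-P⇒≃P n G) (iso⇒ZPolyEq G (P (suc n))) ,
  mk⇔ (λ same → complete⇒≃K G (ZPolyEq-K⇒complete (suc n) G same)) (iso⇒ZPolyEq G (K (suc n)))
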